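{- Let $S\subseteq\mathbb{Z}^+$ and let $n,r\ge0$ be integers with $n+r\ge1$. Then $$\mathcal{D}_{n,S,r}=\sum_{s\in S} (n)_s\, \mathcal{D}_{n-s,S,r} + r\sum_{s\in S} s\,(n)_{s-1}\,\mathcal{D}_{n-(s-1),S,r-1}.$$
   Context: $\mathcal{D}_{n,S,r}$ is the number of sequences of non-empty lists (linearly ordered blocks) with pairwise disjoint label sets covering $[n+r]$, each list of size in $S$, with $1,\dots,r$ in distinct lists. $(n)_m=n(n-1)\cdots(n-m+1)$ is the falling factorial ($(n)_0=1$, and $(n)_m=0$ for $m>n$). Conventions: $\mathcal{D}_{m,S,r}=0$ for $m<0$; when $r=0$ the second sum is multiplied by $0$. -}

module Defs where

open import Data.Nat using (ℕ; zero; suc; _+_; _*_; _∸_; _<ᵇ_; _≤ᵇ_)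
open import Data.Bool using (Bool; true; false; _∧_; not; if_then_else_)
open import Data.Fin using (Fin; toℕ)
open import Data.Fin.Properties using (_≟_)
open import Data.List using (List; []; _∷_; [_]; length; filter; concatMap; concat; allFin)
open import Relation.Nullary.Decidable using (⌊_⌋; does)
open import Data.Nat.Combinatorics using (_P_)

-- Candidate objects: sequences of non-empty lists (blocks) of labels in
-- Fin m with total length k.  Every such sequence is produced exactly once.

private
  ext : {m : ℕ} → Fin m → List (List (Fin m)) → List (List (List (Fin m)))
  ext x []      = []
  ext x (b ∷ σ) = ((x ∷ b) ∷ σ) ∷ []

blockSeqs : (m k : ℕ) → List (List (List (Fin m)))
blockSeqs m zero    = [] ∷ []
blockSeqs m (suc k) =
  concatMap (λ σ → concatMap (λ x → ([ x ] ∷ σ) ∷ ext x σ) (allFin m)) (blockSeqs m k)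

memB : {m : ℕ} → Fin m → List (Fin m) → Bool
memB x []       = false
memB x (y ∷ ys) = does (x ≟ y) Data.Bool.∨ memB x ys

nodup : {m : ℕ} → List (Fin m) → Bool
nodup []       = true
nodup (x ∷ xs) = not (memB x xs) ∧ nodup xs

allB : {A : Set} → (A → Bool) → List A → Bool
allB p []       = true
allB p (x ∷ xs) = p x ∧ allB p xs

-- a block contains at most one of the distinguished labels 1..r
-- (encoded as Fin-indices 0..r-1)
atMostOneSpecial : {m : ℕ} → ℕ → List (Fin m) → Bool
atMostOneSpecial r b = length (filter (λ x → toℕ x Data.Nat.<? r) b) ≤ᵇ 1

-- valid structure on label set [n+r] (= Fin (n+r)) with block sizes in S:
-- blocks pairwise disjoint and covering (total length n+r and no repeated
-- label), every block size in S, labels 1..r in distinct blocks.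
validB : {m : ℕ} → (S : ℕ → Bool) → ℕ → List (List (Fin m)) → Bool
validB S r σ = nodup (concat σ) ∧ allB (λ b → S (length b)) σ
                                ∧ allB (atMostOneSpecial r) σ

𝒟 : ℕ → (ℕ → Bool) → ℕ → ℕ
𝒟 n S r = length (filter (λ σ → validB S r σ Data.Bool.≟ true) (blockSeqs (n + r) (n + r)))

sumS< : (S : ℕ → Bool) → ℕ → (ℕ → ℕ) → ℕ
sumS< S zero    f = 0
sumS< S (suc N) f = sumS< S N f + (if S N then f N else 0)

-- falling factorial (n)_m  (stdlib: n P m, which is 0 for m > n)
ff : ℕ → ℕ → ℕ
ff n m = n P m

{-# OPTIONS --safe #-}
module Submission where

-- Strip off the first block of a sequence.  What follows is a valid sequence on the labels not yet used,
-- and how many there are depends only on the numbers a and c of free ordinary and free special labels.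
-- A first block of size s is filled in (a)_s ways without a special label and in c·s·(a)_(s-1) ways
-- with exactly one, which gives a recursion for that number in the total length.  Starting from a = n,
-- c = r, every count in the recursion is again a value of 𝒟; the falling factorials vanish for s > n + 1.

open import Defs
open import Algebra.Bundles using (CommutativeMonoid)
open import Data.Bool using (Bool; true; false; _∧_; _∨_; not; if_then_else_; T)
open import Data.Bool.Properties using (∧-assoc; ∧-zeroʳ; ∧-identityʳ; ∧-commutativeMonoid)
open import Data.Fin using (Fin; toℕ; zero; suc)
open import Data.Fin.Properties using (_≟_)
open import Data.List using (List; []; _∷_; [_]; _++_; map; concat; concatMap; allFin; length; filter)
open import Data.List.Properties using (map-tabulate)
open import Data.Nat
  using (ℕ; zero; suc; _+_; _*_; _∸_; _≥_; _≤_; _<_; _≤ᵇ_; _≡ᵇ_; _<?_; _≤?_; s≤s; z<s; pred; >-nonZero)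
open import Data.Nat.Combinatorics.Base using (_P′_)
open import Data.Nat.Properties hiding (_≟_)
open import Data.Nat.Tactic.RingSolver using (solve-∀)
open import Data.Sum using (_⊎_; inj₁; inj₂)
open import Function using (_∘_; id)
open import Relation.Binary.PropositionalEquality hiding ([_])
open import Relation.Nullary using (yes; no; does)
open import Relation.Nullary.Decidable using (dec-false)

open import Algebra.Properties.CommutativeSemigroup
  (CommutativeMonoid.commutativeSemigroup ∧-commutativeMonoid)
  using () renaming (interchange to ∧-interchange)
open import Algebra.Properties.CommutativeSemigroup +-commutativeSemigroup
  using () renaming (interchange to +-interchange)
open import Algebra.Properties.CommutativeSemigroup *-commutativeSemigroup
  using () renaming (x∙yz≈y∙xz to x*[y*z]≡y*[x*z])

𝟙 : Bool → ℕ
𝟙 true  = 1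
𝟙 false = 0

𝟙-∧ : ∀ a b → 𝟙 (a ∧ b) ≡ 𝟙 a * 𝟙 b
𝟙-∧ true  b = sym (+-identityʳ (𝟙 b))
𝟙-∧ false b = refl

𝟙-not : ∀ b → 𝟙 (not b) + 𝟙 b ≡ 1
𝟙-not true  = refl
𝟙-not false = refl

𝟙-*-if : ∀ b x → 𝟙 b * x ≡ (if b then x else 0)
𝟙-*-if true  x = +-identityʳ x
𝟙-*-if false x = refl

not-∨ : ∀ a b → not (a ∨ b) ≡ not a ∧ not b
not-∨ true  b = refl
not-∨ false b = refl

𝟙-not-∨ : ∀ a e p → 𝟙 (not a ∧ p) ≡ 𝟙 (not (a ∨ e) ∧ p) + 𝟙 ((not a ∧ p) ∧ e)
𝟙-not-∨ true  e     p     = refl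
𝟙-not-∨ false true  true  = refl
𝟙-not-∨ false true  false = refl
𝟙-not-∨ false false true  = refl
𝟙-not-∨ false false false = refl

𝟙-≤ᵇ1 : ∀ a p n → 𝟙 (a ∧ (p ∧ (n ≤ᵇ 1))) ≡ 𝟙 p * (𝟙 (a ∧ (n ≡ᵇ 0)) + 𝟙 (a ∧ (n ≡ᵇ 1)))
𝟙-≤ᵇ1 false p     n             = sym (*-zeroʳ (𝟙 p))
𝟙-≤ᵇ1 true  false n             = refl
𝟙-≤ᵇ1 true  true  0             = refl
𝟙-≤ᵇ1 true  true  1             = refl
𝟙-≤ᵇ1 true  true  (suc (suc n)) = refl

allB-const-true : ∀ {A : Set} (xs : List A) → allB (λ _ → true) xs ≡ true
allB-const-true []       = refl
allB-const-true (x ∷ xs) = allB-const-true xs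

module _ {A : Set} where

  ∑ : List A → (A → ℕ) → ℕ
  ∑ []       f = 0
  ∑ (x ∷ xs) f = f x + ∑ xs f

  syntax ∑ L (λ x → e) = ∑[ x ∈ L ] e

  ∑-cong : ∀ {f g : A → ℕ} → (∀ x → f x ≡ g x) → ∀ L → ∑ L f ≡ ∑ L g
  ∑-cong f≗g []      = refl
  ∑-cong f≗g (x ∷ L) = cong₂ _+_ (f≗g x) (∑-cong f≗g L)

  ∑-vanishes : ∀ {f : A → ℕ} L → (∀ x → f x ≡ 0) → ∑ L f ≡ 0
  ∑-vanishes []      f≗0 = refl
  ∑-vanishes (x ∷ L) f≗0 = cong₂ _+_ (f≗0 x) (∑-vanishes L f≗0)

  ∑-++ : ∀ xs ys (f : A → ℕ) → ∑ (xs ++ ys) f ≡ ∑ xs f + ∑ ys f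
  ∑-++ []       ys f = refl
  ∑-++ (x ∷ xs) ys f = trans (cong (f x +_) (∑-++ xs ys f)) (sym (+-assoc (f x) _ _))

  ∑-+ : ∀ L (f g : A → ℕ) → ∑[ x ∈ L ] (f x + g x) ≡ ∑ L f + ∑ L g
  ∑-+ []      f g = refl
  ∑-+ (x ∷ L) f g = trans (cong (f x + g x +_) (∑-+ L f g)) (+-interchange (f x) (g x) (∑ L f) (∑ L g))

  ∑-*ˡ : ∀ L c (f : A → ℕ) → ∑[ x ∈ L ] (c * f x) ≡ c * ∑ L f
  ∑-*ˡ []      c f = sym (*-zeroʳ c)
  ∑-*ˡ (x ∷ L) c f = trans (cong (c * f x +_) (∑-*ˡ L c f)) (sym (*-distribˡ-+ c (f x) (∑ L f)))

  ∑-*ʳ : ∀ L c (f : A → ℕ) → ∑[ x ∈ L ] (f x * c) ≡ ∑ L f * c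
  ∑-*ʳ L c f = trans (∑-cong (λ x → *-comm (f x) c) L) (trans (∑-*ˡ L c f) (*-comm c (∑ L f)))

module _ {A B : Set} where

  ∑-map : ∀ (g : A → B) L (f : B → ℕ) → ∑ (map g L) f ≡ ∑[ x ∈ L ] f (g x)
  ∑-map g []      f = refl
  ∑-map g (x ∷ L) f = cong (f (g x) +_) (∑-map g L f)

  ∑-concatMap : ∀ (g : A → List B) L (f : B → ℕ) → ∑ (concatMap g L) f ≡ ∑[ x ∈ L ] ∑ (g x) f
  ∑-concatMap g []      f = refl
  ∑-concatMap g (x ∷ L) f = trans (∑-++ (g x) (concatMap g L) f) (cong (∑ (g x) f +_) (∑-concatMap g L f))

  ∑-comm : ∀ L M (h : A → B → ℕ) → ∑[ x ∈ L ] ∑ M (h x) ≡ ∑[ y ∈ M ] ∑[ x ∈ L ] h x y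
  ∑-comm []      M h = sym (∑-vanishes M (λ _ → refl))
  ∑-comm (x ∷ L) M h = trans (cong (∑ M (h x) +_) (∑-comm L M h)) (sym (∑-+ M (h x) _))

length-filter-≡true : ∀ {A : Set} (p : A → Bool) L →
                      length (filter (λ x → p x Data.Bool.≟ true) L) ≡ ∑[ x ∈ L ] 𝟙 (p x)
length-filter-≡true p []      = refl
length-filter-≡true p (x ∷ L) with p x
... | true  = cong suc (length-filter-≡true p L)
... | false = length-filter-≡true p L

∑< : ℕ → (ℕ → ℕ) → ℕ
∑< zero    f = 0
∑< (suc N) f = ∑< N f + f N

syntax ∑< N (λ j → e) = ∑[ j < N ] e

∑<-cong : ∀ N {f g : ℕ → ℕ} → (∀ j → f j ≡ g j) → ∑< N f ≡ ∑< N g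
∑<-cong zero    f≗g = refl
∑<-cong (suc N) f≗g = cong₂ _+_ (∑<-cong N f≗g) (f≗g N)

∑<-+ : ∀ N (f g : ℕ → ℕ) → ∑[ j < N ] (f j + g j) ≡ ∑< N f + ∑< N g
∑<-+ zero    f g = refl
∑<-+ (suc N) f g = trans (cong (_+ (f N + g N)) (∑<-+ N f g)) (+-interchange (∑< N f) (∑< N g) (f N) (g N))

∑<-*ˡ : ∀ N c (f : ℕ → ℕ) → ∑[ j < N ] (c * f j) ≡ c * ∑< N f
∑<-*ˡ zero    c f = sym (*-zeroʳ c)
∑<-*ˡ (suc N) c f = trans (cong (_+ c * f N) (∑<-*ˡ N c f)) (sym (*-distribˡ-+ c (∑< N f) (f N)))

∑<-suc : ∀ N (f : ℕ → ℕ) → ∑< (suc N) f ≡ f 0 + ∑[ j < N ] f (suc j)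
∑<-suc zero    f = +-comm 0 (f 0)
∑<-suc (suc N) f = trans (cong (_+ f (suc N)) (∑<-suc N f)) (+-assoc (f 0) _ _)

∑<-extend : ∀ d N (f : ℕ → ℕ) → (∀ j → N ≤ j → f j ≡ 0) → ∑< (d + N) f ≡ ∑< N f
∑<-extend zero    N f f≗0 = refl
∑<-extend (suc d) N f f≗0 =
  trans (cong₂ _+_ (∑<-extend d N f f≗0) (f≗0 (d + N) (m≤n+m N d))) (+-identityʳ (∑< N f))

∑<-support : ∀ N M (f : ℕ → ℕ) → (∀ j → N ≤ j → f j ≡ 0) → (∀ j → M ≤ j → f j ≡ 0) →
             ∑< N f ≡ ∑< M f
∑<-support N M f f≗0 f≗0′ = begin
  ∑< N f        ≡⟨ ∑<-extend M N f f≗0 ⟨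
  ∑< (M + N) f  ≡⟨ cong (λ t → ∑< t f) (+-comm M N) ⟩
  ∑< (N + M) f  ≡⟨ ∑<-extend N M f f≗0′ ⟩
  ∑< M f        ∎
  where open ≡-Reasoning

∑-∑< : ∀ {A : Set} L N (h : A → ℕ → ℕ) → ∑[ x ∈ L ] ∑< N (h x) ≡ ∑[ j < N ] ∑[ x ∈ L ] h x j
∑-∑< L zero    h = ∑-vanishes L (λ _ → refl)
∑-∑< L (suc N) h = trans (∑-+ L (λ x → ∑< N (h x)) (λ x → h x N)) (cong (_+ ∑[ x ∈ L ] h x N) (∑-∑< L N h))

sumS<≡∑< : ∀ (S : ℕ → Bool) N f → sumS< S N f ≡ ∑[ s < N ] (if S s then f s else 0)
sumS<≡∑< S zero    f = refl
sumS<≡∑< S (suc N) f = cong (_+ (if S N then f N else 0)) (sumS<≡∑< S N f)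

∑-allFin-suc : ∀ {n} (f : Fin (suc n) → ℕ) → ∑ (allFin (suc n)) f ≡ f zero + ∑[ x ∈ allFin n ] f (suc x)
∑-allFin-suc {n} f =
  cong (f zero +_) (trans (cong (λ L → ∑ L f) (sym (map-tabulate id suc))) (∑-map suc (allFin n) f))

∑-allFin-1 : ∀ n → ∑[ x ∈ allFin n ] 1 ≡ n
∑-allFin-1 zero    = refl
∑-allFin-1 (suc n) = trans (∑-allFin-suc {n} (λ _ → 1)) (cong suc (∑-allFin-1 n))

∑-allFin-∧-≟ : ∀ {n} (p : Fin n → Bool) x → ∑[ y ∈ allFin n ] 𝟙 (p y ∧ does (x ≟ y)) ≡ 𝟙 (p x)
∑-allFin-∧-≟ {suc n} p zero = begin
  ∑[ y ∈ allFin (suc n) ] 𝟙 (p y ∧ does (zero ≟ y))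
    ≡⟨ ∑-allFin-suc (λ y → 𝟙 (p y ∧ does (zero ≟ y))) ⟩
  𝟙 (p zero ∧ true) + ∑[ y ∈ allFin n ] 𝟙 (p (suc y) ∧ false)
    ≡⟨ cong₂ _+_ (cong 𝟙 (∧-identityʳ (p zero))) (∑-vanishes (allFin n) (λ y → cong 𝟙 (∧-zeroʳ (p (suc y))))) ⟩
  𝟙 (p zero) + 0
    ≡⟨ +-identityʳ (𝟙 (p zero)) ⟩
  𝟙 (p zero)
    ∎
  where open ≡-Reasoning
∑-allFin-∧-≟ {suc n} p (suc x) =
  trans (∑-allFin-suc (λ y → 𝟙 (p y ∧ does (suc x ≟ y))))
        (trans (cong (_+ ∑[ y ∈ allFin n ] 𝟙 (p (suc y) ∧ does (x ≟ y))) (cong 𝟙 (∧-zeroʳ (p zero))))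
               (∑-allFin-∧-≟ (p ∘ suc) x))

below : ∀ {m} → ℕ → Fin m → Bool
below r x = does (toℕ x <? r)

count-below : ∀ m r → r ≤ m → ∑[ x ∈ allFin m ] 𝟙 (below r x) ≡ r
count-below zero    zero    _         = refl
count-below (suc m) zero    _         = trans (∑-allFin-suc {m} (𝟙 ∘ below 0))
  (∑-vanishes (allFin m) (λ x → cong 𝟙 (dec-false (toℕ (suc x) <? 0) λ ())))
count-below (suc m) (suc r) (s≤s r≤m) =
  trans (∑-allFin-suc {m} (𝟙 ∘ below (suc r))) (cong suc (count-below m r r≤m))

count-not-below : ∀ n r → ∑[ x ∈ allFin (n + r) ] 𝟙 (not (below r x)) ≡ n
count-not-below n r = +-cancelʳ-≡ r _ n (begin
  #notBelow + r
    ≡⟨ cong (#notBelow +_) (count-below (n + r) r (m≤n+m r n)) ⟨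
  #notBelow + ∑[ x ∈ allFin (n + r) ] 𝟙 (below r x)
    ≡⟨ ∑-+ (allFin (n + r)) (𝟙 ∘ not ∘ below r) (𝟙 ∘ below r) ⟨
  ∑[ x ∈ allFin (n + r) ] (𝟙 (not (below r x)) + 𝟙 (below r x))
    ≡⟨ ∑-cong (𝟙-not ∘ below r) (allFin (n + r)) ⟩
  ∑[ x ∈ allFin (n + r) ] 1
    ≡⟨ ∑-allFin-1 (n + r) ⟩
  n + r
    ∎)
  where
  open ≡-Reasoning
  #notBelow : ℕ
  #notBelow = ∑[ x ∈ allFin (n + r) ] 𝟙 (not (below r x))

fall : ℕ → ℕ → ℕ
fall a zero    = 1
fall a (suc s) = a * fall (a ∸ 1) s

fall-vanishes : ∀ {a s} → a < s → fall a s ≡ 0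
fall-vanishes {zero}  {suc s} _         = refl
fall-vanishes {suc a} {suc s} (s≤s a<s) = trans (cong (suc a *_) (fall-vanishes a<s)) (*-zeroʳ (suc a))

fall-suc-last : ∀ a s → fall a (suc s) ≡ (a ∸ s) * fall a s
fall-suc-last a zero    = refl
fall-suc-last a (suc s) = begin
  a * fall (a ∸ 1) (suc s)              ≡⟨ cong (a *_) (fall-suc-last (a ∸ 1) s) ⟩
  a * ((a ∸ 1 ∸ s) * fall (a ∸ 1) s)    ≡⟨ cong (λ t → a * (t * fall (a ∸ 1) s)) (∸-+-assoc a 1 s) ⟩
  a * ((a ∸ suc s) * fall (a ∸ 1) s)    ≡⟨ x*[y*z]≡y*[x*z] a (a ∸ suc s) (fall (a ∸ 1) s) ⟩
  (a ∸ suc s) * (a * fall (a ∸ 1) s)    ∎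
  where open ≡-Reasoning

P′≡fall : ∀ a s → a P′ s ≡ fall a s
P′≡fall a zero    = refl
P′≡fall a (suc s) = trans (cong ((a ∸ s) *_) (P′≡fall a s)) (sym (fall-suc-last a s))

ff≡fall : ∀ a s → ff a s ≡ fall a s
ff≡fall a s with s ≤ᵇ a in s≤ᵇa
... | true  = P′≡fall a s
... | false = sym (fall-vanishes {a} {s} (≰⇒> (λ s≤a → subst T s≤ᵇa (≤⇒≤ᵇ s≤a))))

module BlockSequences (m : ℕ) where

  Block BlockSeq : Set
  Block    = List (Fin m)
  BlockSeq = List Block

  words : ℕ → List Block
  words zero    = [ [] ]
  words (suc s) = concatMap (λ x → map (x ∷_) (words s)) (allFin m)

  ∑-words-suc : ∀ s (f : Block → ℕ) → ∑ (words (suc s)) f ≡ ∑[ x ∈ allFin m ] ∑[ w ∈ words s ] f (x ∷ w)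
  ∑-words-suc s f = trans (∑-concatMap _ (allFin m) f) (∑-cong (λ x → ∑-map (x ∷_) (words s) f) (allFin m))

  ∑-words-1 : ∀ (f : Block → ℕ) → ∑ (words 1) f ≡ ∑[ x ∈ allFin m ] f [ x ]
  ∑-words-1 f = trans (∑-words-suc 0 f) (∑-cong (λ x → +-identityʳ (f [ x ])) (allFin m))

  ∑-words-length : ∀ s (p : ℕ → Bool) (f : Block → ℕ) →
                   ∑[ w ∈ words s ] (𝟙 (p (length w)) * f w) ≡ 𝟙 (p s) * ∑ (words s) f
  ∑-words-length zero    p f = trans (+-identityʳ _) (cong (𝟙 (p 0) *_) (sym (+-identityʳ (f []))))
  ∑-words-length (suc s) p f = begin
    ∑[ w ∈ words (suc s) ] (𝟙 (p (length w)) * f w)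
      ≡⟨ ∑-words-suc s (λ w → 𝟙 (p (length w)) * f w) ⟩
    ∑[ x ∈ allFin m ] ∑[ w ∈ words s ] (𝟙 (p (suc (length w))) * f (x ∷ w))
      ≡⟨ ∑-cong (λ x → ∑-words-length s (p ∘ suc) (f ∘ (x ∷_))) (allFin m) ⟩
    ∑[ x ∈ allFin m ] (𝟙 (p (suc s)) * ∑[ w ∈ words s ] f (x ∷ w))
      ≡⟨ ∑-*ˡ (allFin m) (𝟙 (p (suc s))) _ ⟩
    𝟙 (p (suc s)) * ∑[ x ∈ allFin m ] ∑[ w ∈ words s ] f (x ∷ w)
      ≡⟨ cong (𝟙 (p (suc s)) *_) (∑-words-suc s f) ⟨
    𝟙 (p (suc s)) * ∑ (words (suc s)) f
      ∎
    where open ≡-Reasoning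

  prependToHead : (BlockSeq → ℕ) → Fin m → BlockSeq → ℕ
  prependToHead f x []      = 0
  prependToHead f x (b ∷ τ) = f ((x ∷ b) ∷ τ)

  ∑-blockSeqs-suc-step : ∀ k (f : BlockSeq → ℕ) →
    ∑ (blockSeqs m (suc k)) f ≡ ∑[ x ∈ allFin m ] ∑[ σ ∈ blockSeqs m k ] f ([ x ] ∷ σ)
                              + ∑[ x ∈ allFin m ] ∑ (blockSeqs m k) (prependToHead f x)
  ∑-blockSeqs-suc-step k f =
    grow _ (blockSeqs m k) λ { x [] → refl ; x (b ∷ τ) → cong (f ([ x ] ∷ b ∷ τ) +_) (+-identityʳ _) }
    where
    -- general in h because the step function of blockSeqs is private to Defs; it is found by unification
    grow : ∀ (h : BlockSeq → Fin m → List BlockSeq) L →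
           (∀ x σ → ∑ (h σ x) f ≡ f ([ x ] ∷ σ) + prependToHead f x σ) →
           ∑ (concatMap (λ σ → concatMap (h σ) (allFin m)) L) f
             ≡ ∑[ x ∈ allFin m ] ∑[ σ ∈ L ] f ([ x ] ∷ σ) + ∑[ x ∈ allFin m ] ∑ L (prependToHead f x)
    grow h L hσx = begin
      ∑ (concatMap (λ σ → concatMap (h σ) (allFin m)) L) f
        ≡⟨ ∑-concatMap _ L f ⟩
      ∑[ σ ∈ L ] ∑ (concatMap (h σ) (allFin m)) f
        ≡⟨ ∑-cong (λ σ → trans (∑-concatMap (h σ) (allFin m) f) (∑-cong (λ x → hσx x σ) (allFin m))) L ⟩
      ∑[ σ ∈ L ] ∑[ x ∈ allFin m ] (f ([ x ] ∷ σ) + prependToHead f x σ)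
        ≡⟨ ∑-cong (λ σ → ∑-+ (allFin m) _ _) L ⟩
      ∑[ σ ∈ L ] (∑[ x ∈ allFin m ] f ([ x ] ∷ σ) + ∑[ x ∈ allFin m ] prependToHead f x σ)
        ≡⟨ ∑-+ L _ _ ⟩
      ∑[ σ ∈ L ] ∑[ x ∈ allFin m ] f ([ x ] ∷ σ) + ∑[ σ ∈ L ] ∑[ x ∈ allFin m ] prependToHead f x σ
        ≡⟨ cong₂ _+_ (∑-comm L (allFin m) _) (∑-comm L (allFin m) _) ⟩
      ∑[ x ∈ allFin m ] ∑[ σ ∈ L ] f ([ x ] ∷ σ) + ∑[ x ∈ allFin m ] ∑ L (prependToHead f x)
        ∎
      where open ≡-Reasoning

  ∑-blockSeqs-suc : ∀ k (f : BlockSeq → ℕ) →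
    ∑ (blockSeqs m (suc k)) f ≡ ∑[ j < suc k ] ∑[ b ∈ words (suc j) ] ∑[ τ ∈ blockSeqs m (k ∸ j) ] f (b ∷ τ)
  ∑-blockSeqs-suc zero f = begin
    ∑ (blockSeqs m 1) f
      ≡⟨ ∑-blockSeqs-suc-step 0 f ⟩
    ∑[ x ∈ allFin m ] (f [ [ x ] ] + 0) + ∑[ x ∈ allFin m ] 0
      ≡⟨ cong₂ _+_ (sym (∑-words-1 _)) (∑-vanishes (allFin m) (λ _ → refl)) ⟩
    ∑[ b ∈ words 1 ] (f [ b ] + 0) + 0
      ≡⟨ +-comm _ 0 ⟩
    0 + ∑[ b ∈ words 1 ] (f [ b ] + 0)
      ∎
    where open ≡-Reasoning
  ∑-blockSeqs-suc (suc k) f = begin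
    ∑ (blockSeqs m (suc (suc k))) f
      ≡⟨ ∑-blockSeqs-suc-step (suc k) f ⟩
    ∑[ x ∈ allFin m ] ∑[ σ ∈ blockSeqs m (suc k) ] f ([ x ] ∷ σ)
      + ∑[ x ∈ allFin m ] ∑ (blockSeqs m (suc k)) (prependToHead f x)
      ≡⟨ cong₂ _+_ (sym (∑-words-1 (λ b → ∑[ τ ∈ blockSeqs m (suc k) ] f (b ∷ τ))))
                   (∑-cong (λ x → ∑-blockSeqs-suc k (prependToHead f x)) (allFin m)) ⟩
    ∑[ b ∈ words 1 ] ∑[ τ ∈ blockSeqs m (suc k) ] f (b ∷ τ)
      + ∑[ x ∈ allFin m ] ∑[ j < suc k ] ∑[ b ∈ words (suc j) ] ∑[ τ ∈ blockSeqs m (k ∸ j) ] f ((x ∷ b) ∷ τ)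
      ≡⟨ cong (∑[ b ∈ words 1 ] ∑[ τ ∈ blockSeqs m (suc k) ] f (b ∷ τ) +_)
              (trans (∑-∑< (allFin m) (suc k) _)
                     (∑<-cong (suc k) λ j →
                        sym (∑-words-suc (suc j) (λ b → ∑[ τ ∈ blockSeqs m (k ∸ j) ] f (b ∷ τ))))) ⟩
    ∑[ b ∈ words 1 ] ∑[ τ ∈ blockSeqs m (suc k) ] f (b ∷ τ)
      + ∑[ j < suc k ] ∑[ b ∈ words (suc (suc j)) ] ∑[ τ ∈ blockSeqs m (k ∸ j) ] f (b ∷ τ)
      ≡⟨ ∑<-suc (suc k) _ ⟨
    ∑[ j < suc (suc k) ] ∑[ b ∈ words (suc j) ] ∑[ τ ∈ blockSeqs m (suc k ∸ j) ] f (b ∷ τ)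
      ∎
    where open ≡-Reasoning

firstBlocks : (ℕ → ℕ → ℕ) → ℕ → ℕ → ℕ → ℕ
firstBlocks G s a c = fall a s * G (a ∸ s) c + c * (s * fall a (s ∸ 1) * G (a ∸ (s ∸ 1)) (c ∸ 1))

-- countFree S fuel k a c counts valid sequences of total length k on a free ordinary and c free special
-- labels; fuel ≥ k only makes the recursion structural.
countFree : (S : ℕ → Bool) (fuel k a c : ℕ) → ℕ
countFree S fuel       zero    a c = 1
countFree S zero       (suc k) a c = 0
countFree S (suc fuel) (suc k) a c =
  ∑[ j < suc k ] (if S (suc j) then firstBlocks (countFree S fuel (k ∸ j)) (suc j) a c else 0)

module Validity (S : ℕ → Bool) (r m : ℕ) where
  open BlockSequences m

  Used : Set
  Used = Fin m → Bool

  use : Used → Fin m → Used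
  use u x y = u y ∨ does (x ≟ y)

  useAll : Used → Block → Used
  useAll u []      = u
  useAll u (x ∷ b) = useAll (use u x) b

  fresh : Used → Block → Bool
  fresh u []      = true
  fresh u (x ∷ b) = not (u x) ∧ fresh (use u x) b

  fresh-++ : ∀ u b c → fresh u (b ++ c) ≡ fresh u b ∧ fresh (useAll u b) c
  fresh-++ u []      c = refl
  fresh-++ u (x ∷ b) c = trans (cong (not (u x) ∧_) (fresh-++ (use u x) b c)) (sym (∧-assoc (not (u x)) _ _))

  allB-avoid-use : ∀ u x xs → allB (not ∘ use u x) xs ≡ allB (not ∘ u) xs ∧ not (memB x xs)
  allB-avoid-use u x []       = refl
  allB-avoid-use u x (y ∷ xs) = begin
    not (u y ∨ does (x ≟ y)) ∧ allB (not ∘ use u x) xs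
      ≡⟨ cong₂ _∧_ (not-∨ (u y) (does (x ≟ y))) (allB-avoid-use u x xs) ⟩
    (not (u y) ∧ not (does (x ≟ y))) ∧ (allB (not ∘ u) xs ∧ not (memB x xs))
      ≡⟨ ∧-interchange (not (u y)) _ _ _ ⟩
    (not (u y) ∧ allB (not ∘ u) xs) ∧ (not (does (x ≟ y)) ∧ not (memB x xs))
      ≡⟨ cong ((not (u y) ∧ allB (not ∘ u) xs) ∧_) (not-∨ (does (x ≟ y)) (memB x xs)) ⟨
    (not (u y) ∧ allB (not ∘ u) xs) ∧ not (does (x ≟ y) ∨ memB x xs)
      ∎
    where open ≡-Reasoning

  fresh≡avoid∧nodup : ∀ u xs → fresh u xs ≡ allB (not ∘ u) xs ∧ nodup xs
  fresh≡avoid∧nodup u []       = refl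
  fresh≡avoid∧nodup u (x ∷ xs) = begin
    not (u x) ∧ fresh (use u x) xs
      ≡⟨ cong (not (u x) ∧_) (fresh≡avoid∧nodup (use u x) xs) ⟩
    not (u x) ∧ (allB (not ∘ use u x) xs ∧ nodup xs)
      ≡⟨ cong (λ t → not (u x) ∧ (t ∧ nodup xs)) (allB-avoid-use u x xs) ⟩
    not (u x) ∧ ((allB (not ∘ u) xs ∧ not (memB x xs)) ∧ nodup xs)
      ≡⟨ cong (not (u x) ∧_) (∧-assoc (allB (not ∘ u) xs) _ _) ⟩
    not (u x) ∧ (allB (not ∘ u) xs ∧ (not (memB x xs) ∧ nodup xs))
      ≡⟨ ∧-assoc (not (u x)) _ _ ⟨
    (not (u x) ∧ allB (not ∘ u) xs) ∧ (not (memB x xs) ∧ nodup xs)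
      ∎
    where open ≡-Reasoning

  fresh-nothingUsed : ∀ xs → fresh (λ _ → false) xs ≡ nodup xs
  fresh-nothingUsed xs = trans (fresh≡avoid∧nodup (λ _ → false) xs) (cong (_∧ nodup xs) (allB-const-true xs))

  goodBlock : Used → Block → Bool
  goodBlock u b = fresh u b ∧ (S (length b) ∧ atMostOneSpecial r b)

  validFrom : Used → BlockSeq → Bool
  validFrom u σ = fresh u (concat σ) ∧ (allB (S ∘ length) σ ∧ allB (atMostOneSpecial r) σ)

  validB≡validFrom-nothingUsed : ∀ σ → validB S r σ ≡ validFrom (λ _ → false) σ
  validB≡validFrom-nothingUsed σ =
    cong (_∧ (allB (S ∘ length) σ ∧ allB (atMostOneSpecial r) σ)) (sym (fresh-nothingUsed (concat σ)))

  validFrom-∷ : ∀ u b τ → validFrom u (b ∷ τ) ≡ goodBlock u b ∧ validFrom (useAll u b) τ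
  validFrom-∷ u b τ = begin
    fresh u (b ++ concat τ)
      ∧ ((S (length b) ∧ allB (S ∘ length) τ) ∧ (atMostOneSpecial r b ∧ allB (atMostOneSpecial r) τ))
      ≡⟨ cong₂ _∧_ (fresh-++ u b (concat τ)) (∧-interchange (S (length b)) _ _ _) ⟩
    (fresh u b ∧ fresh (useAll u b) (concat τ))
      ∧ ((S (length b) ∧ atMostOneSpecial r b) ∧ (allB (S ∘ length) τ ∧ allB (atMostOneSpecial r) τ))
      ≡⟨ ∧-interchange (fresh u b) _ _ _ ⟩
    goodBlock u b ∧ validFrom (useAll u b) τ
      ∎
    where open ≡-Reasoning

  validCount : Used → ℕ → ℕ
  validCount u k = ∑[ σ ∈ blockSeqs m k ] 𝟙 (validFrom u σ)

  validCount-suc : ∀ u k → validCount u (suc k) ≡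
    ∑[ j < suc k ] ∑[ b ∈ words (suc j) ] (𝟙 (goodBlock u b) * validCount (useAll u b) (k ∸ j))
  validCount-suc u k = trans (∑-blockSeqs-suc k (𝟙 ∘ validFrom u))
                             (∑<-cong (suc k) λ j → ∑-cong (λ b → firstBlockOut b (k ∸ j)) (words (suc j)))
    where
    firstBlockOut : ∀ b k′ → ∑[ τ ∈ blockSeqs m k′ ] 𝟙 (validFrom u (b ∷ τ))
                             ≡ 𝟙 (goodBlock u b) * validCount (useAll u b) k′
    firstBlockOut b k′ = begin
      ∑[ τ ∈ blockSeqs m k′ ] 𝟙 (validFrom u (b ∷ τ))
        ≡⟨ ∑-cong (λ τ → trans (cong 𝟙 (validFrom-∷ u b τ)) (𝟙-∧ (goodBlock u b) _)) (blockSeqs m k′) ⟩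
      ∑[ τ ∈ blockSeqs m k′ ] (𝟙 (goodBlock u b) * 𝟙 (validFrom (useAll u b) τ))
        ≡⟨ ∑-*ˡ (blockSeqs m k′) (𝟙 (goodBlock u b)) _ ⟩
      𝟙 (goodBlock u b) * validCount (useAll u b) k′
        ∎
      where open ≡-Reasoning

  special : Fin m → Bool
  special = below r

  specials : Block → ℕ
  specials b = length (filter (λ x → toℕ x <? r) b)

  freeOrdinary freeSpecial : Used → ℕ
  freeOrdinary u = ∑[ x ∈ allFin m ] 𝟙 (not (u x) ∧ not (special x))
  freeSpecial  u = ∑[ x ∈ allFin m ] 𝟙 (not (u x) ∧ special x)

  atFree : (ℕ → ℕ → ℕ) → Used → ℕ
  atFree G u = G (freeOrdinary u) (freeSpecial u)

  ∑-free-use : ∀ u x (p : Fin m → Bool) → u x ≡ false →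
               ∑[ y ∈ allFin m ] 𝟙 (not (use u x y) ∧ p y) ≡ ∑[ y ∈ allFin m ] 𝟙 (not (u y) ∧ p y) ∸ 𝟙 (p x)
  ∑-free-use u x p ux≡false = sym (trans (cong (_∸ 𝟙 (p x)) split) (m+n∸n≡m afterUse (𝟙 (p x))))
    where
    afterUse : ℕ
    afterUse = ∑[ y ∈ allFin m ] 𝟙 (not (use u x y) ∧ p y)
    split : ∑[ y ∈ allFin m ] 𝟙 (not (u y) ∧ p y) ≡ afterUse + 𝟙 (p x)
    split = begin
      ∑[ y ∈ allFin m ] 𝟙 (not (u y) ∧ p y)
        ≡⟨ ∑-cong (λ y → 𝟙-not-∨ (u y) (does (x ≟ y)) (p y)) (allFin m) ⟩
      ∑[ y ∈ allFin m ] (𝟙 (not (use u x y) ∧ p y) + 𝟙 ((not (u y) ∧ p y) ∧ does (x ≟ y)))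
        ≡⟨ ∑-+ (allFin m) _ _ ⟩
      afterUse + ∑[ y ∈ allFin m ] 𝟙 ((not (u y) ∧ p y) ∧ does (x ≟ y))
        ≡⟨ cong (afterUse +_) (∑-allFin-∧-≟ (λ y → not (u y) ∧ p y) x) ⟩
      afterUse + 𝟙 (not (u x) ∧ p x)
        ≡⟨ cong (λ t → afterUse + 𝟙 (not t ∧ p x)) ux≡false ⟩
      afterUse + 𝟙 (p x)
        ∎
      where open ≡-Reasoning

  atFree-use-ordinary : ∀ u x G → u x ≡ false → special x ≡ false →
                        atFree G (use u x) ≡ G (freeOrdinary u ∸ 1) (freeSpecial u)
  atFree-use-ordinary u x G ux≡false sx≡false = cong₂ G
    (trans (∑-free-use u x (not ∘ special) ux≡false) (cong (λ t → freeOrdinary u ∸ 𝟙 (not t)) sx≡false))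
    (trans (∑-free-use u x special ux≡false) (cong (λ t → freeSpecial u ∸ 𝟙 t) sx≡false))

  atFree-use-special : ∀ u x G → u x ≡ false → special x ≡ true →
                       atFree G (use u x) ≡ G (freeOrdinary u) (freeSpecial u ∸ 1)
  atFree-use-special u x G ux≡false sx≡true = cong₂ G
    (trans (∑-free-use u x (not ∘ special) ux≡false) (cong (λ t → freeOrdinary u ∸ 𝟙 (not t)) sx≡true))
    (trans (∑-free-use u x special ux≡false) (cong (λ t → freeSpecial u ∸ 𝟙 t) sx≡true))

  freshWithSpecials : ℕ → Used → Block → Bool
  freshWithSpecials i u b = fresh u b ∧ (specials b ≡ᵇ i)

  freshBlockWeight : ℕ → (ℕ → ℕ → ℕ) → Used → Block → ℕ
  freshBlockWeight i G u b = 𝟙 (freshWithSpecials i u b) * atFree G (useAll u b)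

  ∑-words-noSpecial : ∀ s u G →
    ∑ (words s) (freshBlockWeight 0 G u)
      ≡ fall (freeOrdinary u) s * G (freeOrdinary u ∸ s) (freeSpecial u)
  ∑-words-noSpecial zero    u G = +-identityʳ _
  ∑-words-noSpecial (suc s) u G = begin
    ∑ (words (suc s)) (freshBlockWeight 0 G u)
      ≡⟨ ∑-words-suc s _ ⟩
    ∑[ x ∈ allFin m ] ∑[ b ∈ words s ] freshBlockWeight 0 G u (x ∷ b)
      ≡⟨ ∑-cong byHead (allFin m) ⟩
    ∑[ x ∈ allFin m ] (𝟙 (not (u x) ∧ not (special x)) * K)
      ≡⟨ ∑-*ʳ (allFin m) K _ ⟩
    a * (fall (a ∸ 1) s * G (a ∸ 1 ∸ s) c)
      ≡⟨ cong (λ t → a * (fall (a ∸ 1) s * G t c)) (∸-+-assoc a 1 s) ⟩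
    a * (fall (a ∸ 1) s * G (a ∸ suc s) c)
      ≡⟨ *-assoc a _ _ ⟨
    fall a (suc s) * G (a ∸ suc s) c
      ∎
    where
    open ≡-Reasoning
    a c K : ℕ
    a = freeOrdinary u
    c = freeSpecial u
    K = fall (a ∸ 1) s * G (a ∸ 1 ∸ s) c
    byHead : ∀ x → ∑[ b ∈ words s ] freshBlockWeight 0 G u (x ∷ b)
                     ≡ 𝟙 (not (u x) ∧ not (special x)) * K
    byHead x with u x in ux | special x in sx
    ... | true  | _     = ∑-vanishes (words s) (λ _ → refl)
    ... | false | true  = ∑-vanishes (words s) λ b →
      cong (λ t → 𝟙 t * atFree G (useAll u (x ∷ b))) (∧-zeroʳ (fresh (use u x) b))
    ... | false | false = begin
      ∑ (words s) (freshBlockWeight 0 G (use u x))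
        ≡⟨ ∑-words-noSpecial s (use u x) G ⟩
      atFree (λ a c → fall a s * G (a ∸ s) c) (use u x)
        ≡⟨ atFree-use-ordinary u x (λ a c → fall a s * G (a ∸ s) c) ux sx ⟩
      K
        ≡⟨ +-identityʳ K ⟨
      1 * K
        ∎

  ∑-words-oneSpecial : ∀ s u G →
    ∑ (words s) (freshBlockWeight 1 G u)
      ≡ freeSpecial u * (s * fall (freeOrdinary u) (s ∸ 1) * G (freeOrdinary u ∸ (s ∸ 1)) (freeSpecial u ∸ 1))
  ∑-words-oneSpecial zero    u G = sym (*-zeroʳ (freeSpecial u))
  ∑-words-oneSpecial (suc s) u G = begin
    ∑ (words (suc s)) (freshBlockWeight 1 G u)
      ≡⟨ ∑-words-suc s _ ⟩
    ∑[ x ∈ allFin m ] ∑[ b ∈ words s ] freshBlockWeight 1 G u (x ∷ b)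
      ≡⟨ ∑-cong byHead (allFin m) ⟩
    ∑[ x ∈ allFin m ] (𝟙 (not (u x) ∧ special x) * K₁ + 𝟙 (not (u x) ∧ not (special x)) * K₂)
      ≡⟨ ∑-+ (allFin m) _ _ ⟩
    ∑[ x ∈ allFin m ] (𝟙 (not (u x) ∧ special x) * K₁)
      + ∑[ x ∈ allFin m ] (𝟙 (not (u x) ∧ not (special x)) * K₂)
      ≡⟨ cong₂ _+_ (∑-*ʳ (allFin m) K₁ _) (∑-*ʳ (allFin m) K₂ _) ⟩
    c * K₁ + a * K₂
      ≡⟨ combine s ⟩
    c * (suc s * fall a s * G (a ∸ s) (c ∸ 1))
      ∎
    where
    open ≡-Reasoning
    a c K₁ K₂ : ℕ
    a  = freeOrdinary u
    c  = freeSpecial u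
    K₁ = fall a s * G (a ∸ s) (c ∸ 1)
    K₂ = c * (s * fall (a ∸ 1) (s ∸ 1) * G (a ∸ 1 ∸ (s ∸ 1)) (c ∸ 1))
    combine : ∀ s → c * (fall a s * G (a ∸ s) (c ∸ 1))
                    + a * (c * (s * fall (a ∸ 1) (s ∸ 1) * G (a ∸ 1 ∸ (s ∸ 1)) (c ∸ 1)))
                  ≡ c * (suc s * fall a s * G (a ∸ s) (c ∸ 1))
    combine zero    = identity a c (G a (c ∸ 1))
      where
      identity : ∀ a c g → c * (1 * g) + a * (c * 0) ≡ c * (1 * 1 * g)
      identity = solve-∀
    combine (suc s) rewrite ∸-+-assoc a 1 s = identity a c s (fall (a ∸ 1) s) (G (a ∸ suc s) (c ∸ 1))
      where
      identity : ∀ a c s f g → c * (a * f * g) + a * (c * (suc s * f * g)) ≡ c * (suc (suc s) * (a * f) * g)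
      identity = solve-∀
    byHead : ∀ x → ∑[ b ∈ words s ] freshBlockWeight 1 G u (x ∷ b)
                     ≡ 𝟙 (not (u x) ∧ special x) * K₁ + 𝟙 (not (u x) ∧ not (special x)) * K₂
    byHead x with u x in ux | special x in sx
    ... | true  | _     = ∑-vanishes (words s) (λ _ → refl)
    ... | false | true  = begin
      ∑ (words s) (freshBlockWeight 0 G (use u x))
        ≡⟨ ∑-words-noSpecial s (use u x) G ⟩
      atFree (λ a c → fall a s * G (a ∸ s) c) (use u x)
        ≡⟨ atFree-use-special u x (λ a c → fall a s * G (a ∸ s) c) ux sx ⟩
      K₁
        ≡⟨ trans (+-identityʳ _) (+-identityʳ K₁) ⟨
      1 * K₁ + 0 * K₂
        ∎
    ... | false | false = begin
      ∑ (words s) (freshBlockWeight 1 G (use u x))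
        ≡⟨ ∑-words-oneSpecial s (use u x) G ⟩
      atFree (λ a c → c * (s * fall a (s ∸ 1) * G (a ∸ (s ∸ 1)) (c ∸ 1))) (use u x)
        ≡⟨ atFree-use-ordinary u x (λ a c → c * (s * fall a (s ∸ 1) * G (a ∸ (s ∸ 1)) (c ∸ 1))) ux sx ⟩
      K₂
        ≡⟨ +-identityʳ K₂ ⟨
      0 * K₁ + 1 * K₂
        ∎

  ∑-words-goodBlock : ∀ s u G →
    ∑[ b ∈ words s ] (𝟙 (goodBlock u b) * atFree G (useAll u b)) ≡ 𝟙 (S s) * atFree (firstBlocks G s) u
  ∑-words-goodBlock s u G = begin
    ∑[ b ∈ words s ] (𝟙 (goodBlock u b) * atFree G (useAll u b))
      ≡⟨ ∑-cong splitBySpecials (words s) ⟩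
    ∑[ b ∈ words s ] (𝟙 (S (length b)) * (freshBlockWeight 0 G u b + freshBlockWeight 1 G u b))
      ≡⟨ ∑-words-length s S _ ⟩
    𝟙 (S s) * ∑[ b ∈ words s ] (freshBlockWeight 0 G u b + freshBlockWeight 1 G u b)
      ≡⟨ cong (𝟙 (S s) *_) (trans (∑-+ (words s) (freshBlockWeight 0 G u) (freshBlockWeight 1 G u))
                                  (cong₂ _+_ (∑-words-noSpecial s u G) (∑-words-oneSpecial s u G))) ⟩
    𝟙 (S s) * atFree (firstBlocks G s) u
      ∎
    where
    open ≡-Reasoning
    splitBySpecials : ∀ b → 𝟙 (goodBlock u b) * atFree G (useAll u b)
                            ≡ 𝟙 (S (length b)) * (freshBlockWeight 0 G u b + freshBlockWeight 1 G u b)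
    splitBySpecials b = begin
      𝟙 (goodBlock u b) * g
        ≡⟨ cong (_* g) (𝟙-≤ᵇ1 (fresh u b) (S (length b)) (specials b)) ⟩
      𝟙 (S (length b)) * (𝟙 (freshWithSpecials 0 u b) + 𝟙 (freshWithSpecials 1 u b)) * g
        ≡⟨ *-assoc (𝟙 (S (length b))) _ g ⟩
      𝟙 (S (length b)) * ((𝟙 (freshWithSpecials 0 u b) + 𝟙 (freshWithSpecials 1 u b)) * g)
        ≡⟨ cong (𝟙 (S (length b)) *_)
                (*-distribʳ-+ g (𝟙 (freshWithSpecials 0 u b)) (𝟙 (freshWithSpecials 1 u b))) ⟩
      𝟙 (S (length b)) * (freshBlockWeight 0 G u b + freshBlockWeight 1 G u b)
        ∎
      where
      g : ℕ
      g = atFree G (useAll u b)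

  validCount≡countFree : ∀ k fuel → k ≤ fuel → ∀ u → validCount u k ≡ atFree (countFree S fuel k) u
  validCount≡countFree zero    fuel       _           u = refl
  validCount≡countFree (suc k) (suc fuel) (s≤s k≤fuel) u =
    trans (validCount-suc u k) (∑<-cong (suc k) λ j → begin
      ∑[ b ∈ words (suc j) ] (𝟙 (goodBlock u b) * validCount (useAll u b) (k ∸ j))
        ≡⟨ ∑-cong (λ b → cong (𝟙 (goodBlock u b) *_)
                             (validCount≡countFree (k ∸ j) fuel (≤-trans (m∸n≤m k j) k≤fuel) (useAll u b)))
                  (words (suc j)) ⟩
      ∑[ b ∈ words (suc j) ] (𝟙 (goodBlock u b) * atFree (countFree S fuel (k ∸ j)) (useAll u b))
        ≡⟨ ∑-words-goodBlock (suc j) u (countFree S fuel (k ∸ j)) ⟩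
      𝟙 (S (suc j)) * atFree (firstBlocks (countFree S fuel (k ∸ j)) (suc j)) u
        ≡⟨ 𝟙-*-if (S (suc j)) _ ⟩
      (if S (suc j) then atFree (firstBlocks (countFree S fuel (k ∸ j)) (suc j)) u else 0)
        ∎)
    where open ≡-Reasoning

𝒟≡countFree : ∀ (S : ℕ → Bool) n r fuel → n + r ≤ fuel → 𝒟 n S r ≡ countFree S fuel (n + r) n r
𝒟≡countFree S n r fuel n+r≤fuel = begin
  𝒟 n S r
    ≡⟨ length-filter-≡true (validB S r) (blockSeqs (n + r) (n + r)) ⟩
  ∑[ σ ∈ blockSeqs (n + r) (n + r) ] 𝟙 (validB S r σ)
    ≡⟨ ∑-cong (cong 𝟙 ∘ validB≡validFrom-nothingUsed) (blockSeqs (n + r) (n + r)) ⟩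
  validCount (λ _ → false) (n + r)
    ≡⟨ validCount≡countFree (n + r) fuel n+r≤fuel (λ _ → false) ⟩
  countFree S fuel (n + r) (freeOrdinary (λ _ → false)) (freeSpecial (λ _ → false))
    ≡⟨ cong₂ (countFree S fuel (n + r)) (count-not-below n r) (count-below (n + r) r (m≤n+m r n)) ⟩
  countFree S fuel (n + r) n r
    ∎
  where
  open ≡-Reasoning
  open Validity S r (n + r)

n+r≤j⇒r≡0⊎n<j : ∀ {n r j} → n + r ≤ j → r ≡ 0 ⊎ n < j
n+r≤j⇒r≡0⊎n<j {r = zero}    _     = inj₁ refl
n+r≤j⇒r≡0⊎n<j {n} {suc r} n+r≤j = inj₂ (<-≤-trans (m<m+n n z<s) n+r≤j)

fall*countFree≡ff*𝒟 : ∀ S n r i {fuel t} → n + r ∸ i ≡ t → t ≤ fuel →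
                       fall n i * countFree S fuel t (n ∸ i) r ≡ ff n i * 𝒟 (n ∸ i) S r
fall*countFree≡ff*𝒟 S n r i {fuel} {t} n+r∸i≡t t≤fuel with i ≤? n
... | yes i≤n = cong₂ _*_ (sym (ff≡fall n i)) (sym (begin
  𝒟 (n ∸ i) S r
    ≡⟨ 𝒟≡countFree S (n ∸ i) r fuel (subst (_≤ fuel) (sym n∸i+r≡t) t≤fuel) ⟩
  countFree S fuel (n ∸ i + r) (n ∸ i) r
    ≡⟨ cong (λ t → countFree S fuel t (n ∸ i) r) n∸i+r≡t ⟩
  countFree S fuel t (n ∸ i) r
    ∎))
  where
  open ≡-Reasoning
  n∸i+r≡t : n ∸ i + r ≡ t
  n∸i+r≡t = trans (sym (+-∸-comm r i≤n)) n+r∸i≡t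
... | no i≰n = trans (cong (_* countFree S fuel t (n ∸ i) r) (fall-vanishes (≰⇒> i≰n)))
                     (sym (cong (_* 𝒟 (n ∸ i) S r) (trans (ff≡fall n i) (fall-vanishes (≰⇒> i≰n)))))

module Recurrence (S : ℕ → Bool) (n r : ℕ) where

  ordinaryTerm specialTerm term : ℕ → ℕ
  ordinaryTerm s = ff n s * 𝒟 (n ∸ s) S r
  specialTerm  s = s * ff n (s ∸ 1) * 𝒟 (n ∸ (s ∸ 1)) S (r ∸ 1)
  term         s = (if S s then ordinaryTerm s else 0) + r * (if S s then specialTerm s else 0)

  firstBlocks≡terms : ∀ k j → n + r ≡ suc k →
    firstBlocks (countFree S k (k ∸ j)) (suc j) n r ≡ ordinaryTerm (suc j) + r * specialTerm (suc j)
  firstBlocks≡terms k j n+r≡1+k =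
    cong₂ _+_ (fall*countFree≡ff*𝒟 S n r (suc j) (cong (_∸ suc j) n+r≡1+k) (m∸n≤m k j))
              (specialHead r n+r≡1+k)
    where
    specialHead : ∀ r → n + r ≡ suc k → r * (suc j * fall n j * countFree S k (k ∸ j) (n ∸ j) (r ∸ 1))
                                          ≡ r * (suc j * ff n j * 𝒟 (n ∸ j) S (r ∸ 1))
    specialHead zero     _           = refl
    specialHead (suc r′) n+1+r′≡1+k = cong (suc r′ *_) (begin
      suc j * fall n j * countFree S k (k ∸ j) (n ∸ j) r′
        ≡⟨ *-assoc (suc j) (fall n j) _ ⟩
      suc j * (fall n j * countFree S k (k ∸ j) (n ∸ j) r′)
        ≡⟨ cong (suc j *_) (fall*countFree≡ff*𝒟 S n r′ j n+r′∸j≡k∸j (m∸n≤m k j)) ⟩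
      suc j * (ff n j * 𝒟 (n ∸ j) S r′)
        ≡⟨ *-assoc (suc j) (ff n j) _ ⟨
      suc j * ff n j * 𝒟 (n ∸ j) S r′
        ∎)
      where
      open ≡-Reasoning
      n+r′∸j≡k∸j : n + r′ ∸ j ≡ k ∸ j
      n+r′∸j≡k∸j = cong (_∸ j) (suc-injective (trans (sym (+-suc n r′)) n+1+r′≡1+k))

  𝒟≡∑term : ∀ k → n + r ≡ suc k → 𝒟 n S r ≡ ∑[ j < suc k ] term (suc j)
  𝒟≡∑term k n+r≡1+k = begin
    𝒟 n S r
      ≡⟨ 𝒟≡countFree S n r (suc k) (≤-reflexive n+r≡1+k) ⟩
    countFree S (suc k) (n + r) n r
      ≡⟨ cong (λ t → countFree S (suc k) t n r) n+r≡1+k ⟩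
    ∑[ j < suc k ] (if S (suc j) then firstBlocks (countFree S k (k ∸ j)) (suc j) n r else 0)
      ≡⟨ ∑<-cong (suc k) byFirstBlockSize ⟩
    ∑[ j < suc k ] term (suc j)
      ∎
    where
    open ≡-Reasoning
    byFirstBlockSize : ∀ j → (if S (suc j) then firstBlocks (countFree S k (k ∸ j)) (suc j) n r else 0)
                             ≡ term (suc j)
    byFirstBlockSize j with S (suc j)
    ... | true  = firstBlocks≡terms k j n+r≡1+k
    ... | false = sym (*-zeroʳ r)

  term-vanishes : ∀ j → n ≤ j → r ≡ 0 ⊎ n < j → term (suc j) ≡ 0
  term-vanishes j n≤j r≡0⊎n<j with S (suc j)
  ... | false = *-zeroʳ r
  ... | true  rewrite ff≡fall n (suc j) | fall-vanishes {n} {suc j} (s≤s n≤j) = specialHead r≡0⊎n<j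
    where
    specialHead : r ≡ 0 ⊎ n < j → r * specialTerm (suc j) ≡ 0
    specialHead (inj₁ refl) = refl
    specialHead (inj₂ n<j)  rewrite ff≡fall n j | fall-vanishes n<j | *-zeroʳ (suc j) = *-zeroʳ r

  term-0 : S 0 ≡ false → term 0 ≡ 0
  term-0 S0≡false rewrite S0≡false = *-zeroʳ r

  ∑term≡sumS< : ∀ N → ∑< N term ≡ sumS< S N ordinaryTerm + r * sumS< S N specialTerm
  ∑term≡sumS< N = begin
    ∑< N term
      ≡⟨ ∑<-+ N _ _ ⟩
    ∑[ s < N ] (if S s then ordinaryTerm s else 0) + ∑[ s < N ] (r * (if S s then specialTerm s else 0))
      ≡⟨ cong₂ _+_ (sumS<≡∑< S N ordinaryTerm)
                   (trans (cong (r *_) (sumS<≡∑< S N specialTerm)) (sym (∑<-*ˡ N r _))) ⟨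
    sumS< S N ordinaryTerm + r * sumS< S N specialTerm
      ∎
    where open ≡-Reasoning

mainTheorem17 : (S : ℕ → Bool) → S 0 ≡ false → (n r : ℕ) → n + r ≥ 1 →
    𝒟 n S r ≡ sumS< S (n + 2) (λ s → ff n s * 𝒟 (n ∸ s) S r)
              + r * sumS< S (n + 2) (λ s → s * ff n (s ∸ 1) * 𝒟 (n ∸ (s ∸ 1)) S (r ∸ 1))
mainTheorem17 S S0≡false n r n+r≥1 = begin
  𝒟 n S r                               ≡⟨ 𝒟≡∑term k (sym (suc-pred (n + r) {{>-nonZero n+r≥1}})) ⟩
  ∑[ j < suc k ] term (suc j)           ≡⟨ ∑<-support (suc k) (suc n) (term ∘ suc) beyond-n+r beyond-n ⟩
  ∑[ j < suc n ] term (suc j)           ≡⟨ cong (_+ ∑[ j < suc n ] term (suc j)) (term-0 S0≡false) ⟨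
  term 0 + ∑[ j < suc n ] term (suc j)  ≡⟨ ∑<-suc (suc n) term ⟨
  ∑< (2 + n) term                       ≡⟨ cong (λ N → ∑< N term) (+-comm 2 n) ⟩
  ∑< (n + 2) term                       ≡⟨ ∑term≡sumS< (n + 2) ⟩
  sumS< S (n + 2) ordinaryTerm + r * sumS< S (n + 2) specialTerm ∎
  where
  open ≡-Reasoning
  open Recurrence S n r
  k : ℕ
  k = pred (n + r)
  beyond-n+r : ∀ j → suc k ≤ j → term (suc j) ≡ 0
  beyond-n+r j 1+k≤j = term-vanishes j (≤-trans (m≤m+n n r) n+r≤j) (n+r≤j⇒r≡0⊎n<j n+r≤j)
    where
    n+r≤j : n + r ≤ j
    n+r≤j = subst (_≤ j) (suc-pred (n + r) {{>-nonZero n+r≥1}}) 1+k≤j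
  beyond-n : ∀ j → suc n ≤ j → term (suc j) ≡ 0
  beyond-n j n<j = term-vanishes j (<⇒≤ n<j) (inj₂ n<j)
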